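{- Let $\mathcal{R}$ be a symmetric $d$-class association scheme with relations $A_0,A_1,\ldots,A_d$ and let $\Gamma$ be its fusing-relations graph. Assume that $\{i,j\}$ is an edge of $\Gamma$, and let $\mathcal{R}'$ be the association scheme obtained from $\mathcal{R}$ by fusing $A_i$ and $A_j$. Then the fusing-relations graph of $\mathcal{R}'$ contains $\Gamma/ij$ as a subgraph.
   Context: A symmetric $d$-class association scheme on a finite set $X$ is a set $\mathcal{R}=\{A_0,\dots,A_d\}$ of $X\times X$ $01$-matrices with $A_0=I$, $\sum_iA_i=J$, $A_i^\top=A_i$, $A_iA_j=\sum_h p_{ij}^hA_h$. A pair $\{A_i,A_j\}$ ($i\ne j$, $i,j\ge1$) fuses if replacing $A_i,A_j$ by $A_i+A_j$ (keeping the others) yields an association scheme. The fusing-relations graph of $\mathcal{R}$ has vertex set $\{1,\dots,d\}$ with $i\sim j$ iff $\{A_i,A_j\}$ fuses. For $\mathcal{R}'$ (relations $A_h$, $h\ne i,j$, and $A_i+A_j$), its fusing-relations graph is taken on vertex set $([d]\setminus\{i,j\})\cup\{ij\}$, where vertex $ij$ corresponds to $A_i+A_j$. The contraction $\Gamma/ij$ is the simple graph on the same vertex set obtained from $\Gamma$ by replacing $i,j$ with the single vertex $ij$, joining $ij$ to $h\ne i,j$ iff $h$ is adjacent in $\Gamma$ to at least one of $i,j$, and keeping all edges of $\Gamma$ among vertices other than $i,j$. -}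

module Defs where

open import Data.Nat using (ℕ; zero; suc; _+_; _*_)
open import Data.Fin using (Fin; zero; suc; punchIn; _≟_)
open import Data.Product using (Σ; ∃; _×_; _,_)
open import Data.Sum using (_⊎_)
open import Relation.Binary.PropositionalEquality using (_≡_; _≢_)
open import Relation.Nullary using (does)
open import Data.Bool using (if_then_else_)

Mat : ℕ → Set
Mat n = Fin n → Fin n → ℕ

∑ : ∀ {m} → (Fin m → ℕ) → ℕ
∑ {zero}  f = 0
∑ {suc m} f = f zero + ∑ (λ k → f (suc k))

I : ∀ {n} → Mat n
I x y = if does (x ≟ y) then 1 else 0

_⊗_ : ∀ {n} → Mat n → Mat n → Mat n
(M ⊗ N) x y = ∑ (λ z → M x z * N z y)

record IsSymScheme (n d : ℕ) (A : Fin (suc d) → Mat n) : Set where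
  field
    zero-one  : ∀ k x y → A k x y ≡ 0 ⊎ A k x y ≡ 1
    nonzero   : ∀ k → Σ (Fin n) λ x → Σ (Fin n) λ y → A k x y ≡ 1
    A₀≡I      : ∀ x y → A zero x y ≡ I x y
    sum≡J     : ∀ x y → ∑ (λ k → A k x y) ≡ 1
    symmetric : ∀ k x y → A k x y ≡ A k y x
    closed    : ∀ k l → Σ (Fin (suc d) → ℕ) λ p →
                  ∀ x y → (A k ⊗ A l) x y ≡ ∑ (λ h → p h * A h x y)

-- Fusing classes c and c' (class c ↔ relation A (suc c)) of a family with
-- suc d₁ classes.  The result has d₁ classes: new class m corresponds to old
-- class punchIn c' m (i.e. c' is deleted), and the new class whose old index
-- is c carries A (suc c) + A (suc c').
fuse : ∀ {n d₁} → (Fin (suc (suc d₁)) → Mat n) → Fin (suc d₁) → Fin (suc d₁) →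
       Fin (suc d₁) → Mat n
fuse A c c' zero    x y = A zero x y
fuse A c c' (suc m) x y =
  if does (punchIn c' m ≟ c)
  then A (suc c) x y + A (suc c') x y
  else A (suc (punchIn c' m)) x y

-- Fusing-relations graph: vertices = classes Fin (suc d₁) (i.e. 1..d),
-- c ∼ c' iff c ≠ c' and fusing them yields an association scheme.
FusingAdj : ∀ {n d₁} → (Fin (suc (suc d₁)) → Mat n) → Fin (suc d₁) → Fin (suc d₁) → Set
FusingAdj {n} {d₁} A c c' = c ≢ c' × IsSymScheme n d₁ (fuse A c c')

-- Contraction Γ/ij on vertex set Fin d₁ = the classes of the fused scheme
-- (vertex u corresponds to old vertex punchIn j u; the vertex with
-- punchIn j u ≡ i is the merged vertex ij).
-- Represents u w : old vertex w is one of the old vertices merged into u.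
Represents : ∀ {d₁} → Fin (suc d₁) → Fin (suc d₁) → Fin d₁ → Fin (suc d₁) → Set
Represents i j u w = w ≡ punchIn j u ⊎ (punchIn j u ≡ i × w ≡ j)

Contract : ∀ {d₁} → (Fin (suc d₁) → Fin (suc d₁) → Set) →
           Fin (suc d₁) → Fin (suc d₁) → Fin d₁ → Fin d₁ → Set
Contract Γ i j u v =
  u ≢ v × Σ (Fin _) λ w → Σ (Fin _) λ w' →
    Represents i j u w × Represents i j v w' × Γ w w'

-- A matrix constant on the classes of a partition is a combination of its relations, so a
-- symmetric partition whose relation products are constant on its classes is a scheme; in a scheme
-- the matrices constant on the classes are closed under product.  Let B = fuse A i j and
-- C = fuse A w w' (both schemes) and D = fuse B u v, where w, w' are merged into u, v.  Every
-- relation of D is a union of classes of B and also of C, so every product D k ⊗ D l is constant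
-- on the classes of B and of C.  The only class of D that is not a class of B is the union of the
-- classes u and v of B, and the class w ∪ w' of C meets both of them, so D k ⊗ D l is constant on
-- it too.

module Submission where

open import Defs
open import Data.Bool using (if_then_else_)
open import Data.Nat using (ℕ; zero; suc; _+_; _*_; _≤_)
import Data.Nat.Properties as ℕ
open import Algebra.Properties.Semiring.Sum ℕ.+-*-semiring
  using (sum; sum-cong-≗; sum-remove; sum-replicate-zero; ∑-distrib-+; ∑-comm; *-distribˡ-sum; *-distribʳ-sum)
open import Algebra.Properties.CommutativeSemigroup ℕ.*-commutativeSemigroup using (x∙yz≈y∙xz)
open import Data.Fin using (Fin; zero; suc; punchIn; punchOut; _≟_)
open import Data.Fin.Properties using (punchInᵢ≢i; punchIn-punchOut; punchIn-injective; suc-injective)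
open import Data.Product using (Σ; ∃; _×_; _,_; proj₁; proj₂)
open import Data.Sum using (_⊎_; inj₁; inj₂)
open import Data.Empty using (⊥-elim)
open import Function using (_∘_)
open import Relation.Nullary using (yes; no)
open import Relation.Nullary.Decidable using (dec-true; dec-false)
open import Relation.Binary.PropositionalEquality

∑≡sum : ∀ {m} (f : Fin m → ℕ) → ∑ f ≡ sum f
∑≡sum {zero}  f = refl
∑≡sum {suc m} f = cong (f zero +_) (∑≡sum (f ∘ suc))

sum-zero : ∀ {m} (f : Fin m → ℕ) → (∀ k → f k ≡ 0) → sum f ≡ 0
sum-zero {m} f f≡0 = trans (sum-cong-≗ f≡0) (sum-replicate-zero m)

sum-supported : ∀ {m} (f : Fin m → ℕ) k → (∀ h → h ≢ k → f h ≡ 0) → sum f ≡ f k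
sum-supported {suc m} f k off = begin
  sum f                      ≡⟨ sum-remove f ⟩
  f k + sum (f ∘ punchIn k)  ≡⟨ cong (f k +_) (sum-zero _ (λ h → off _ (punchInᵢ≢i k h))) ⟩
  f k + 0                    ≡⟨ ℕ.+-identityʳ (f k) ⟩
  f k                        ∎
  where open ≡-Reasoning

≤-sum : ∀ {m} (f : Fin m → ℕ) k → f k ≤ sum f
≤-sum {suc m} f k = subst (f k ≤_) (sym (sum-remove f)) (ℕ.m≤m+n (f k) _)

sum≡1⇒∃≡1 : ∀ {m} (f : Fin m → ℕ) → (∀ k → f k ≡ 0 ⊎ f k ≡ 1) → sum f ≡ 1 → ∃ λ k → f k ≡ 1
sum≡1⇒∃≡1 {suc m} f f01 Σf≡1 with f01 zero
... | inj₂ f₀≡1 = zero , f₀≡1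
... | inj₁ f₀≡0 with sum≡1⇒∃≡1 (f ∘ suc) (f01 ∘ suc) (trans (cong (_+ sum (f ∘ suc)) (sym f₀≡0)) Σf≡1)
...   | k , fk≡1 = suc k , fk≡1

sum≡1⇒others≡0 : ∀ {m} (f : Fin m → ℕ) → sum f ≡ 1 → ∀ {k h} → f k ≡ 1 → h ≢ k → f h ≡ 0
sum≡1⇒others≡0 {suc m} f Σf≡1 {k} {h} fk≡1 h≢k = ℕ.n≤0⇒n≡0 (begin
  f h                                 ≡⟨ cong f (punchIn-punchOut k≢h) ⟨
  f (punchIn k (punchOut k≢h))        ≤⟨ ≤-sum (f ∘ punchIn k) _ ⟩
  sum (f ∘ punchIn k)                 ≡⟨ rest≡0 ⟩
  0                                   ∎)
  where
  open ℕ.≤-Reasoning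
  k≢h : k ≢ h
  k≢h = h≢k ∘ sym
  rest≡0 : sum (f ∘ punchIn k) ≡ 0
  rest≡0 = ℕ.suc-injective
    (trans (cong (_+ sum (f ∘ punchIn k)) (sym fk≡1)) (trans (sym (sum-remove f)) Σf≡1))

m+n≡1⇒m≡1∨n≡1 : ∀ m n → m + n ≡ 1 → m ≡ 1 ⊎ n ≡ 1
m+n≡1⇒m≡1∨n≡1 zero          n m+n≡1 = inj₂ m+n≡1
m+n≡1⇒m≡1∨n≡1 (suc zero)    n _     = inj₁ refl
m+n≡1⇒m≡1∨n≡1 (suc (suc m)) n ()

lincomb : ∀ {n m} → (Fin m → ℕ) → (Fin m → Mat n) → Mat n
lincomb a Ms x y = sum (λ h → a h * Ms h x y)

⊗≡sum : ∀ {n} (M N : Mat n) x y → (M ⊗ N) x y ≡ sum (λ z → M x z * N z y)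
⊗≡sum M N x y = ∑≡sum (λ z → M x z * N z y)

⊗-cong : ∀ {n} {M M' N N' : Mat n} → (∀ x y → M x y ≡ M' x y) → (∀ x y → N x y ≡ N' x y) →
         ∀ x y → (M ⊗ N) x y ≡ (M' ⊗ N') x y
⊗-cong {M = M} {M'} {N} {N'} M≗M' N≗N' x y = begin
  (M ⊗ N) x y                     ≡⟨ ⊗≡sum M N x y ⟩
  sum (λ z → M x z * N z y)       ≡⟨ sum-cong-≗ (λ z → cong₂ _*_ (M≗M' x z) (N≗N' z y)) ⟩
  sum (λ z → M' x z * N' z y)     ≡⟨ ⊗≡sum M' N' x y ⟨
  (M' ⊗ N') x y                   ∎
  where open ≡-Reasoning

⊗-linearˡ : ∀ {n m} (a : Fin m → ℕ) (Ms : Fin m → Mat n) (N : Mat n) x y →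
            (lincomb a Ms ⊗ N) x y ≡ lincomb a (λ h → Ms h ⊗ N) x y
⊗-linearˡ a Ms N x y = begin
  (lincomb a Ms ⊗ N) x y
    ≡⟨ ⊗≡sum (lincomb a Ms) N x y ⟩
  sum (λ z → sum (λ h → a h * Ms h x z) * N z y)
  
    ≡⟨ sum-cong-≗ (λ z → *-distribʳ-sum (N z y) (λ h → a h * Ms h x z)) ⟩
  sum (λ z → sum (λ h → a h * Ms h x z * N z y))
    ≡⟨ ∑-comm (λ z h → a h * Ms h x z * N z y) ⟩
  sum (λ h → sum (λ z → a h * Ms h x z * N z y))
  
    ≡⟨ sum-cong-≗ (λ h → sum-cong-≗ (λ z → ℕ.*-assoc (a h) (Ms h x z) (N z y))) ⟩
  sum (λ h → sum (λ z → a h * (Ms h x z * N z y)))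
  
    ≡⟨ sum-cong-≗ (λ h → *-distribˡ-sum (a h) (λ z → Ms h x z * N z y)) ⟨
  sum (λ h → a h * sum (λ z → Ms h x z * N z y))
  
    ≡⟨ sum-cong-≗ (λ h → cong (a h *_) (⊗≡sum (Ms h) N x y)) ⟨
  lincomb a (λ h → Ms h ⊗ N) x y ∎
  where open ≡-Reasoning

⊗-linearʳ : ∀ {n m} (b : Fin m → ℕ) (M : Mat n) (Ns : Fin m → Mat n) x y →
            (M ⊗ lincomb b Ns) x y ≡ lincomb b (λ h → M ⊗ Ns h) x y
⊗-linearʳ b M Ns x y = begin
  (M ⊗ lincomb b Ns) x y
    ≡⟨ ⊗≡sum M (lincomb b Ns) x y ⟩
  sum (λ z → M x z * sum (λ h → b h * Ns h z y))
  
    ≡⟨ sum-cong-≗ (λ z → *-distribˡ-sum (M x z) (λ h → b h * Ns h z y)) ⟩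
  sum (λ z → sum (λ h → M x z * (b h * Ns h z y)))
    ≡⟨ ∑-comm (λ z h → M x z * (b h * Ns h z y)) ⟩
  sum (λ h → sum (λ z → M x z * (b h * Ns h z y)))
  
    ≡⟨ sum-cong-≗ (λ h → sum-cong-≗ (λ z → x∙yz≈y∙xz (M x z) (b h) (Ns h z y))) ⟩
  sum (λ h → sum (λ z → b h * (M x z * Ns h z y)))
  
    ≡⟨ sum-cong-≗ (λ h → *-distribˡ-sum (b h) (λ z → M x z * Ns h z y)) ⟨
  sum (λ h → b h * sum (λ z → M x z * Ns h z y))
  
    ≡⟨ sum-cong-≗ (λ h → cong (b h *_) (⊗≡sum M (Ns h) x y)) ⟨
  lincomb b (λ h → M ⊗ Ns h) x y ∎
  where open ≡-Reasoning

SameClass : ∀ {n m} → (Fin m → Mat n) → (x y x' y' : Fin n) → Set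
SameClass F x y x' y' = ∀ h → F h x y ≡ F h x' y'

ConstantOn : ∀ {n m} → (Fin m → Mat n) → Mat n → Set
ConstantOn {n} F M = ∀ (x y x' y' : Fin n) → SameClass F x y x' y' → M x y ≡ M x' y'

Refines : ∀ {n m m'} → (Fin m → Mat n) → (Fin m' → Mat n) → Set
Refines F G = ∀ h → ConstantOn F (G h)

refines-refl : ∀ {n m} (F : Fin m → Mat n) → Refines F F
refines-refl F h x y x' y' s = s h

constantOn-≗ : ∀ {n m} {F : Fin m → Mat n} {M M' : Mat n} →
               (∀ x y → M x y ≡ M' x y) → ConstantOn F M' → ConstantOn F M
constantOn-≗ M≗M' cM' x y x' y' s = trans (M≗M' x y) (trans (cM' x y x' y' s) (sym (M≗M' x' y')))

constantOn-lincomb : ∀ {n m m'} {F : Fin m → Mat n} (a : Fin m' → ℕ) (Ms : Fin m' → Mat n) →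
                     Refines F Ms → ConstantOn F (lincomb a Ms)
constantOn-lincomb a Ms cMs x y x' y' s = sum-cong-≗ (λ h → cong (a h *_) (cMs h x y x' y' s))

record IsPartition (n d : ℕ) (F : Fin (suc d) → Mat n) : Set where
  field
    zero-one : ∀ k x y → F k x y ≡ 0 ⊎ F k x y ≡ 1
    nonzero  : ∀ k → Σ (Fin n) λ x → Σ (Fin n) λ y → F k x y ≡ 1
    sum≡J    : ∀ x y → sum (λ k → F k x y) ≡ 1

  classOf : ∀ x y → ∃ λ k → F k x y ≡ 1
  classOf x y = sum≡1⇒∃≡1 (λ k → F k x y) (λ k → zero-one k x y) (sum≡J x y)

  outside-class : ∀ {k h x y} → F k x y ≡ 1 → h ≢ k → F h x y ≡ 0
  outside-class {x = x} {y} = sum≡1⇒others≡0 (λ k → F k x y) (sum≡J x y)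

  sameClass : ∀ {k x y x' y'} → F k x y ≡ 1 → F k x' y' ≡ 1 → SameClass F x y x' y'
  sameClass {k} Fkxy≡1 Fkx'y'≡1 h with h ≟ k
  ... | yes refl = trans Fkxy≡1 (sym Fkx'y'≡1)
  ... | no h≢k   = trans (outside-class Fkxy≡1 h≢k) (sym (outside-class Fkx'y'≡1 h≢k))

  rep₁ rep₂ : Fin (suc d) → Fin n
  rep₁ h = proj₁ (nonzero h)
  rep₂ h = proj₁ (proj₂ (nonzero h))

  rep-∈ : ∀ h → F h (rep₁ h) (rep₂ h) ≡ 1
  rep-∈ h = proj₂ (proj₂ (nonzero h))

  constantOn⇒lincomb : ∀ {M} → ConstantOn F M →
                       ∀ x y → M x y ≡ lincomb (λ h → M (rep₁ h) (rep₂ h)) F x y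
  constantOn⇒lincomb {M} cM x y with classOf x y
  ... | k , Fkxy≡1 = begin
    M x y
      ≡⟨ cM x y _ _ (sameClass Fkxy≡1 (rep-∈ k)) ⟩
    M (rep₁ k) (rep₂ k)
      ≡⟨ ℕ.*-identityʳ _ ⟨
    M (rep₁ k) (rep₂ k) * 1
      ≡⟨ cong (M (rep₁ k) (rep₂ k) *_) Fkxy≡1 ⟨
    M (rep₁ k) (rep₂ k) * F k x y
      ≡⟨ sum-supported (λ h → M (rep₁ h) (rep₂ h) * F h x y) k off-class ⟨
    lincomb (λ h → M (rep₁ h) (rep₂ h)) F x y ∎
    where
    open ≡-Reasoning
    off-class : ∀ h → h ≢ k → M (rep₁ h) (rep₂ h) * F h x y ≡ 0
    off-class h h≢k =
      trans (cong (M (rep₁ h) (rep₂ h) *_) (outside-class Fkxy≡1 h≢k)) (ℕ.*-zeroʳ (M (rep₁ h) (rep₂ h)))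

  constant⇒closed : (∀ k l → ConstantOn F (F k ⊗ F l)) →
                    ∀ k l → Σ (Fin (suc d) → ℕ) λ p → ∀ x y → (F k ⊗ F l) x y ≡ ∑ (λ h → p h * F h x y)
  constant⇒closed cFF k l =
    p , λ x y → trans (constantOn⇒lincomb (cFF k l) x y) (sym (∑≡sum (λ h → p h * F h x y)))
    where
    p : Fin (suc d) → ℕ
    p h = (F k ⊗ F l) (rep₁ h) (rep₂ h)

isPartition : ∀ {n d} {F : Fin (suc d) → Mat n} → IsSymScheme n d F → IsPartition n d F
isPartition {F = F} S = record
  { zero-one = zero-one
  ; nonzero  = nonzero
  ; sum≡J    = λ x y → trans (sym (∑≡sum (λ k → F k x y))) (sum≡J x y)
  }
  where open IsSymScheme S

module SymScheme {n d} {F : Fin (suc d) → Mat n} (S : IsSymScheme n d F) where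
  open IsPartition (isPartition S)

  constantOn-⊗-basis : ∀ k l → ConstantOn F (F k ⊗ F l)
  constantOn-⊗-basis k l with IsSymScheme.closed S k l
  ... | p , FkFl≡ =
    constantOn-≗ (λ x y → trans (FkFl≡ x y) (∑≡sum (λ h → p h * F h x y)))
                 (constantOn-lincomb p F (refines-refl F))

  constantOn-⊗ : ∀ {M N} → ConstantOn F M → ConstantOn F N → ConstantOn F (M ⊗ N)
  constantOn-⊗ {M} {N} cM cN =
    constantOn-≗ M⊗N≡lincomb
      (constantOn-lincomb a _ (λ h → constantOn-lincomb b _ (λ h' → constantOn-⊗-basis h h')))
    where
    a b : Fin (suc d) → ℕ
    a h = M (rep₁ h) (rep₂ h)
    b h = N (rep₁ h) (rep₂ h)
    M⊗N≡lincomb : ∀ x y → (M ⊗ N) x y ≡ lincomb a (λ h → lincomb b (λ h' → F h ⊗ F h')) x y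
    M⊗N≡lincomb x y = begin
      (M ⊗ N) x y
      
        ≡⟨ ⊗-cong (constantOn⇒lincomb cM) (constantOn⇒lincomb cN) x y ⟩
      (lincomb a F ⊗ lincomb b F) x y
        ≡⟨ ⊗-linearˡ a F (lincomb b F) x y ⟩
      lincomb a (λ h → F h ⊗ lincomb b F) x y
      
        ≡⟨ sum-cong-≗ (λ h → cong (a h *_) (⊗-linearʳ b (F h) F x y)) ⟩
      lincomb a (λ h → lincomb b (λ h' → F h ⊗ F h')) x y ∎
      where open ≡-Reasoning

module Fusion {n d₁} {F : Fin (suc (suc d₁)) → Mat n} (P : IsPartition n (suc d₁) F)
              {c c' : Fin (suc d₁)} (c≢c' : c ≢ c') where
  open IsPartition P

  G : Fin (suc d₁) → Mat n
  G = fuse F c c'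

  data FusedClass (m : Fin d₁) : Set where
    merged : punchIn c' m ≡ c → (∀ x y → G (suc m) x y ≡ F (suc c) x y + F (suc c') x y) → FusedClass m
    kept   : punchIn c' m ≢ c → (∀ x y → G (suc m) x y ≡ F (suc (punchIn c' m)) x y) → FusedClass m

  fusedClass : ∀ m → FusedClass m
  fusedClass m with punchIn c' m ≟ c
  ... | yes c'm≡c = merged c'm≡c (λ _ _ → cong (λ b → if b then _ else _) (dec-true (punchIn c' m ≟ c) c'm≡c))
  ... | no  c'm≢c = kept c'm≢c (λ _ _ → cong (λ b → if b then _ else _) (dec-false (punchIn c' m ≟ c) c'm≢c))

  InMerged : Fin n → Fin n → Set
  InMerged x y = F (suc c) x y ≡ 1 ⊎ F (suc c') x y ≡ 1

  merged-sum : ∀ {x y} → InMerged x y → F (suc c) x y + F (suc c') x y ≡ 1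
  merged-sum (inj₁ Fcxy≡1)  = cong₂ _+_ Fcxy≡1 (outside-class Fcxy≡1 (c≢c' ∘ sym ∘ suc-injective))
  merged-sum (inj₂ Fc'xy≡1) = cong₂ _+_ (outside-class Fc'xy≡1 (c≢c' ∘ suc-injective)) Fc'xy≡1

  merged-outside : ∀ {x y} → InMerged x y → ∀ k → k ≢ suc c → k ≢ suc c' → F k x y ≡ 0
  merged-outside (inj₁ Fcxy≡1)  k k≢c _    = outside-class Fcxy≡1 k≢c
  merged-outside (inj₂ Fc'xy≡1) k _   k≢c' = outside-class Fc'xy≡1 k≢c'

  fuse-refines : Refines F G
  fuse-refines zero    x y x' y' s = s zero
  fuse-refines (suc m) x y x' y' s with fusedClass m
  ... | merged _ G≡ = trans (G≡ x y) (trans (cong₂ _+_ (s (suc c)) (s (suc c'))) (sym (G≡ x' y')))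
  ... | kept   _ G≡ = trans (G≡ x y) (trans (s (suc (punchIn c' m))) (sym (G≡ x' y')))

  sameClass-merged : ∀ {x y x' y'} → InMerged x y → InMerged x' y' → SameClass G x y x' y'
  sameClass-merged xy x'y' zero =
    trans (merged-outside xy zero (λ ()) (λ ())) (sym (merged-outside x'y' zero (λ ()) (λ ())))
  sameClass-merged {x} {y} {x'} {y'} xy x'y' (suc m) with fusedClass m
  ... | merged _ G≡ = trans (G≡ x y) (trans (merged-sum xy) (sym (trans (G≡ x' y') (merged-sum x'y'))))
  ... | kept c'm≢c G≡ =
    trans (G≡ x y) (trans (merged-outside xy _ ≢c ≢c')
                          (sym (trans (G≡ x' y') (merged-outside x'y' _ ≢c ≢c'))))
    where
    ≢c : suc (punchIn c' m) ≢ suc c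
    ≢c = c'm≢c ∘ suc-injective
    ≢c' : suc (punchIn c' m) ≢ suc c'
    ≢c' = punchInᵢ≢i c' m ∘ suc-injective

  fuse-zero-one : ∀ k x y → G k x y ≡ 0 ⊎ G k x y ≡ 1
  fuse-zero-one zero    = zero-one zero
  fuse-zero-one (suc m) x y with fusedClass m
  ... | kept _ G≡ = subst (λ t → t ≡ 0 ⊎ t ≡ 1) (sym (G≡ x y)) (zero-one _ x y)
  ... | merged _ G≡ with zero-one (suc c) x y | zero-one (suc c') x y
  ...   | inj₂ Fcxy≡1 | _            = inj₂ (trans (G≡ x y) (merged-sum (inj₁ Fcxy≡1)))
  ...   | inj₁ _      | inj₂ Fc'xy≡1 = inj₂ (trans (G≡ x y) (merged-sum (inj₂ Fc'xy≡1)))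
  ...   | inj₁ Fcxy≡0 | inj₁ Fc'xy≡0 = inj₁ (trans (G≡ x y) (cong₂ _+_ Fcxy≡0 Fc'xy≡0))

  fuse-nonzero : ∀ k → Σ (Fin n) λ x → Σ (Fin n) λ y → G k x y ≡ 1
  fuse-nonzero zero = nonzero zero
  fuse-nonzero (suc m) with fusedClass m
  ... | merged _ G≡ = rep₁ (suc c) , rep₂ (suc c) , trans (G≡ _ _) (merged-sum (inj₁ (rep-∈ (suc c))))
  ... | kept   _ G≡ = rep₁ k , rep₂ k , trans (G≡ _ _) (rep-∈ k)
    where
    k : Fin (suc (suc d₁))
    k = suc (punchIn c' m)

  private
    mergedPart : Fin n → Fin n → Fin d₁ → ℕ
    mergedPart x y m with fusedClass m
    ... | merged _ _ = F (suc c') x y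
    ... | kept   _ _ = 0

    fuse-split : ∀ x y m → G (suc m) x y ≡ F (suc (punchIn c' m)) x y + mergedPart x y m
    fuse-split x y m with fusedClass m
    ... | merged c'm≡c G≡ = trans (G≡ x y) (cong (λ t → F (suc t) x y + F (suc c') x y) (sym c'm≡c))
    ... | kept   _     G≡ = trans (G≡ x y) (sym (ℕ.+-identityʳ _))

    sum-mergedPart : ∀ x y → sum (mergedPart x y) ≡ F (suc c') x y
    sum-mergedPart x y = trans (sum-supported (mergedPart x y) m₀ off-m₀) at-m₀
      where
      c'≢c : c' ≢ c
      c'≢c = c≢c' ∘ sym
      m₀ : Fin d₁
      m₀ = punchOut c'≢c
      off-m₀ : ∀ m → m ≢ m₀ → mergedPart x y m ≡ 0
      off-m₀ m m≢m₀ with fusedClass m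
      ... | merged c'm≡c _ =
        ⊥-elim (m≢m₀ (punchIn-injective c' m m₀ (trans c'm≡c (sym (punchIn-punchOut c'≢c)))))
      ... | kept   _     _ = refl
      at-m₀ : mergedPart x y m₀ ≡ F (suc c') x y
      at-m₀ with fusedClass m₀
      ... | merged _ _     = refl
      ... | kept c'm₀≢c _  = ⊥-elim (c'm₀≢c (punchIn-punchOut c'≢c))

  fuse-sum≡J : ∀ x y → sum (λ k → G k x y) ≡ 1
  fuse-sum≡J x y = begin
    F zero x y + sum (λ m → G (suc m) x y)
      ≡⟨ cong (F zero x y +_) (trans (sum-cong-≗ (fuse-split x y)) (∑-distrib-+ Fₒ (mergedPart x y))) ⟩
    F zero x y + (sum Fₒ + sum (mergedPart x y))
      ≡⟨ cong (λ t → F zero x y + (sum Fₒ + t)) (sum-mergedPart x y) ⟩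
    F zero x y + (sum Fₒ + F (suc c') x y)
      ≡⟨ cong (F zero x y +_) (trans (ℕ.+-comm (sum Fₒ) _) (sym (sum-remove (λ k → F (suc k) x y)))) ⟩
    F zero x y + sum (λ k → F (suc k) x y)
      ≡⟨ sum≡J x y ⟩
    1 ∎
    where
    open ≡-Reasoning
    Fₒ : Fin d₁ → ℕ
    Fₒ m = F (suc (punchIn c' m)) x y

  fuse-isPartition : IsPartition n d₁ G
  fuse-isPartition = record { zero-one = fuse-zero-one ; nonzero = fuse-nonzero ; sum≡J = fuse-sum≡J }

  fuse-symmetric : (∀ k x y → F k x y ≡ F k y x) → ∀ k x y → G k x y ≡ G k y x
  fuse-symmetric F-sym zero    x y = F-sym zero x y
  fuse-symmetric F-sym (suc m) x y with fusedClass m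
  ... | merged _ G≡ = trans (G≡ x y) (trans (cong₂ _+_ (F-sym _ x y) (F-sym _ x y)) (sym (G≡ y x)))
  ... | kept   _ G≡ = trans (G≡ x y) (trans (F-sym _ x y) (sym (G≡ y x)))

  sameClass-fuse⁻ : ∀ {x y x' y'} → SameClass G x y x' y' →
                    SameClass F x y x' y' ⊎ (InMerged x y × InMerged x' y')
  sameClass-fuse⁻ {x} {y} {x'} {y'} s with IsPartition.classOf fuse-isPartition x y
  ... | zero  , Gxy≡1 = inj₁ (sameClass Gxy≡1 (trans (sym (s zero)) Gxy≡1))
  ... | suc m , Gxy≡1 with fusedClass m
  ...   | merged _ G≡ = inj₂ ( m+n≡1⇒m≡1∨n≡1 _ _ (trans (sym (G≡ x y)) Gxy≡1)
                             , m+n≡1⇒m≡1∨n≡1 _ _ (trans (sym (G≡ x' y')) (trans (sym (s (suc m))) Gxy≡1)))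
  ...   | kept   _ G≡ = inj₁ (sameClass (trans (sym (G≡ x y)) Gxy≡1)
                                        (trans (sym (G≡ x' y')) (trans (sym (s (suc m))) Gxy≡1)))

  constantOn-fuse : ∀ {M p₁ p₂ q₁ q₂} → ConstantOn F M →
                    F (suc c) p₁ p₂ ≡ 1 → F (suc c') q₁ q₂ ≡ 1 → M p₁ p₂ ≡ M q₁ q₂ → ConstantOn G M
  constantOn-fuse {M} {p₁} {p₂} cM p∈c q∈c' Mp≡Mq x y x' y' s with sameClass-fuse⁻ s
  ... | inj₁ sF          = cM x y x' y' sF
  ... | inj₂ (xy , x'y') = trans (≡Mp xy) (sym (≡Mp x'y'))
    where
    ≡Mp : ∀ {x y} → InMerged x y → M x y ≡ M p₁ p₂
    ≡Mp (inj₁ e) = cM _ _ _ _ (sameClass e p∈c)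
    ≡Mp (inj₂ e) = trans (cM _ _ _ _ (sameClass e q∈c')) (sym Mp≡Mq)

  fuse-represents : ∀ {u w x y} → Represents c c' u w → F (suc w) x y ≡ 1 → G (suc u) x y ≡ 1
  fuse-represents {u} {x = x} {y} r Fw≡1 with fusedClass u | r
  ... | merged c'u≡c G≡ | inj₁ refl        =
    trans (G≡ x y) (merged-sum (inj₁ (subst (λ t → F (suc t) x y ≡ 1) c'u≡c Fw≡1)))
  ... | merged _     G≡ | inj₂ (_ , refl)   = trans (G≡ x y) (merged-sum (inj₂ Fw≡1))
  ... | kept   _     G≡ | inj₁ refl        = trans (G≡ x y) Fw≡1
  ... | kept   c'u≢c _  | inj₂ (c'u≡c , _) = ⊥-elim (c'u≢c c'u≡c)

module IteratedFusion {n e} {A : Fin (suc (suc (suc e))) → Mat n} (PA : IsPartition n (suc (suc e)) A)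
                      {i j : Fin (suc (suc e))} (i≢j : i ≢ j) {u v : Fin (suc e)} (u≢v : u ≢ v) where
  module AB = Fusion PA i≢j
  module BD = Fusion AB.fuse-isPartition u≢v

  inMerged-fuse : ∀ {w w'} (w≢w' : w ≢ w') → Represents i j u w → Represents i j v w' →
                  ∀ {x y} → Fusion.InMerged PA w≢w' x y → BD.InMerged x y
  inMerged-fuse _ u∋w _    (inj₁ Awxy≡1)  = inj₁ (AB.fuse-represents u∋w Awxy≡1)
  inMerged-fuse _ _   v∋w' (inj₂ Aw'xy≡1) = inj₂ (AB.fuse-represents v∋w' Aw'xy≡1)

  fuse-refines-fuse-fuse : ∀ {w w'} (w≢w' : w ≢ w') → Represents i j u w → Represents i j v w' →
                           Refines (fuse A w w') (fuse (fuse A i j) u v)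
  fuse-refines-fuse-fuse w≢w' u∋w v∋w' h x y x' y' s with Fusion.sameClass-fuse⁻ PA w≢w' s
  ... | inj₁ sA          = BD.fuse-refines h x y x' y' (λ k → AB.fuse-refines k x y x' y' sA)
  ... | inj₂ (xy , x'y') =
    BD.sameClass-merged (inMerged-fuse w≢w' u∋w v∋w' xy) (inMerged-fuse w≢w' u∋w v∋w' x'y') h

lemma5p1 : (n e : ℕ) (A : Fin (suc (suc (suc e))) → Mat n) →
    IsSymScheme n (suc (suc e)) A →
    (i j : Fin (suc (suc e))) → FusingAdj A i j →
    ∀ (u v : Fin (suc e)) → Contract (FusingAdj A) i j u v → FusingAdj (fuse A i j) u v
lemma5p1 n e A SA i j (i≢j , SB) u v (u≢v , w , w' , u∋w , v∋w' , w≢w' , SC) = u≢v , SD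
  where
  open IteratedFusion (isPartition SA) i≢j u≢v
  open IsPartition (isPartition SA) using (rep-∈)

  D : Fin (suc e) → Mat n
  D = fuse (fuse A i j) u v

  C⊑D : Refines (fuse A w w') D
  C⊑D = fuse-refines-fuse-fuse w≢w' u∋w v∋w'

  products-constant : ∀ k l → ConstantOn D (D k ⊗ D l)
  products-constant k l =
    BD.constantOn-fuse (SymScheme.constantOn-⊗ SB (BD.fuse-refines k) (BD.fuse-refines l))
      (AB.fuse-represents u∋w (rep-∈ (suc w))) (AB.fuse-represents v∋w' (rep-∈ (suc w')))
      (SymScheme.constantOn-⊗ SC (C⊑D k) (C⊑D l) _ _ _ _
        (Fusion.sameClass-merged (isPartition SA) w≢w' (inj₁ (rep-∈ (suc w))) (inj₂ (rep-∈ (suc w')))))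

  SD : IsSymScheme n e D
  SD = record
    { zero-one  = zero-one
    ; nonzero   = nonzero
    ; A₀≡I      = IsSymScheme.A₀≡I SB
    ; sum≡J     = λ x y → trans (∑≡sum (λ k → D k x y)) (sum≡J x y)
    ; symmetric = BD.fuse-symmetric (IsSymScheme.symmetric SB)
    ; closed    = constant⇒closed products-constant
    }
    where open IsPartition BD.fuse-isPartition
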